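{- For all positive integers $n$ and $p$, \[ n^p=\sum_{\ell=0}^{p-1}(-1)^{\ell}\,c_{p,\ell}\,F_n^{\,p-\ell}, \] where $F_n^{k}=\binom{n+k-1}{k}$ and the coefficients $c_{p,\ell}$ are defined below. Consequently, for all positive integers $n,p$, \[ \sum_{r=1}^{n} r^p=\sum_{i=1}^{p}(-1)^{i-1}c_{p,i-1}\,F_n^{\,p-i+2}. \]
   Context: For positive integers $n,k$, $F_n^{k}=\binom{n+k-1}{k}$ denotes the $n$th hyper-tetrahedron (figurate) number of dimension $k$. For a finite tuple $(k_1,\dots,k_m)$ of nonnegative integers ($m\ge 0$), its content is $\sum_{i=1}^m k_i$ and its support is the number of indices $i$ with $k_i>0$. For integers $p\ge1$ and $0\le \ell\le p-1$, define \[ c_{p,\ell}=\sum_{(k_1,\dots,k_m)}\frac{p!}{(k_1+1)!(k_2+1)!\cdots(k_m+1)!}, \] where the sum runs over all $m\ge 0$ and all $m$-tuples $(k_1,\dots,k_m)$ of nonnegative integers with content $\ell$ and support $s=m+\ell+1-p$, such that for every $j<m$, $k_j>0$ implies $k_{j+1}=0$ (the empty tuple, when admissible, contributes $p!$). (Equivalently, $c_{p,\ell}$ counts the $(p-\ell)$-dimensional simplices cut out of the cube $0\le x_1,\dots,x_p\le n-1$ by chains $x_{\sigma_1}L_1x_{\sigma_2}L_2\cdots L_{p-1}x_{\sigma_p}$, $\sigma$ a permutation of $\{1,\dots,p\}$, with exactly $\ell$ of the symbols $L_i$ equal to "$=$" and the rest "$\ge$".) -}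

module Defs where

open import Data.Nat using (ℕ; zero; suc; _+_; _*_; _∸_; _^_; _<ᵇ_; _≡ᵇ_; _!)
open import Data.Nat.Properties using (_!≢0)
open import Data.Nat.Combinatorics using (_C_)
open import Data.Bool using (Bool; true; false; _∧_; _∨_)
open import Data.List using (List; []; _∷_; map; concatMap; upTo; filter; length; foldr)
open import Data.Integer using (+_)
open import Data.Rational using (ℚ; _/_; 0ℚ; 1ℚ; -_) renaming (_+_ to _+ℚ_; _*_ to _*ℚ_)
open import Relation.Nullary.Decidable using (yes; no)
open import Data.Bool using (T?)

ℕ→ℚ : ℕ → ℚ
ℕ→ℚ k = + k / 1

Σℚ : List ℚ → ℚ
Σℚ = foldr _+ℚ_ 0ℚ

Πℚ : List ℚ → ℚ
Πℚ = foldr _*ℚ_ 1ℚ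

range : ℕ → ℕ → List ℕ
range lo hi = map (λ j → lo + j) (upTo (suc hi ∸ lo))

sgn : ℕ → ℚ
sgn zero    = 1ℚ
sgn (suc k) = - sgn k

F : ℕ → ℕ → ℕ
F n k = (n + k ∸ 1) C k

tuples : ℕ → ℕ → List (List ℕ)
tuples zero    b = [] ∷ []
tuples (suc m) b = concatMap (λ k → map (k ∷_) (tuples m b)) (upTo (suc b))

content : List ℕ → ℕ
content = foldr _+_ 0

support : List ℕ → ℕ
support []       = 0
support (k ∷ ks) with 0 <ᵇ k
... | true  = suc (support ks)
... | false = support ks

noAdjacent : List ℕ → Bool
noAdjacent (x ∷ y ∷ ks) = ((x ≡ᵇ 0) ∨ (y ≡ᵇ 0)) ∧ noAdjacent (y ∷ ks)
noAdjacent _            = true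

-- content ℓ, support s with s = m + ℓ + 1 - p (stated without truncated
-- subtraction as s + p = m + ℓ + 1), and the adjacency condition
admissible : ℕ → ℕ → List ℕ → Bool
admissible p ℓ ks =
  (content ks ≡ᵇ ℓ) ∧ ((support ks + p) ≡ᵇ (length ks + ℓ + 1)) ∧ noAdjacent ks

term : ℕ → List ℕ → ℚ
term p ks = ℕ→ℚ (p !) *ℚ Πℚ (map (λ k → (+ 1 / (suc k) !) {{suc k !≢0}}) ks)

-- admissible tuples: lengths m ∈ [0, p+ℓ], entries ∈ [0, ℓ].
-- (Any admissible tuple has entries ≤ content = ℓ and, since
--  support ≤ content, m + ℓ + 1 - p ≤ ℓ, i.e. m ≤ p - 1; so this finite
--  enumeration contains every admissible tuple exactly once.)
admissibleTuples : ℕ → ℕ → List (List ℕ)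
admissibleTuples p ℓ =
  filter (λ ks → T? (admissible p ℓ ks)) (concatMap (λ m → tuples m ℓ) (range 0 (p + ℓ)))

c : ℕ → ℕ → ℚ
c p ℓ = Σℚ (map (term p) (admissibleTuples p ℓ))

{-# OPTIONS --safe #-}
module Submission where

-- A tuple counted by c p ℓ consists of p − ℓ − 1 zeros with at most one positive entry k in each
-- of the p − ℓ gaps they leave; reading each gap as a part of size k + 1 gives a composition of p
-- into p − ℓ parts, weighted by p! / ∏ (parts)!. Hence c p ℓ = (p − ℓ)! S(p, p − ℓ), the number of
-- surjections of a p-set onto a (p − ℓ)-set, and these obey the recurrence
-- surj (p + 1) ℓ = (p + 1 − ℓ) (surj p (ℓ − 1) + surj p ℓ). Combined with (k + 1) Fₙᵏ⁺¹ = (n + k) Fₙᵏ this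
-- makes the alternating sum get multiplied by n when p increases by one, so it equals nᵖ.
-- Summing over n with the hockey-stick identity ∑_{r ≤ n} Fᵣᵏ = Fₙᵏ⁺¹ gives the second formula.

open import Defs
open import Data.Nat using (ℕ; zero; suc; _+_; _*_; _∸_; _^_; _!; _<_; _≤_; z≤n; s≤s; _≡ᵇ_; NonZero)
import Data.Nat.Properties as ℕ
open import Data.Nat.Properties using (_!≢0)
import Data.Nat.Coprimality as Coprime
import Data.Nat.Solver as ℕ-Solver
open import Data.Nat.Combinatorics using (_C_; nCk+nC[k+1]≡[n+1]C[k+1]; k>n⇒nCk≡0; nC1≡n)
open import Data.Bool using (Bool; true; false; _∧_; if_then_else_)
open import Data.Bool.Properties using (∧-zeroʳ)
open import Data.List using (List; []; _∷_; map; upTo; applyUpTo; filter; concat; concatMap; _++_; length)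
import Data.List.Properties as List
import Data.Integer as ℤ
import Data.Integer.Properties as ℤ
open import Data.Rational using (ℚ; mkℚ; _/_; 0ℚ; 1ℚ; -_) renaming (_+_ to _+ℚ_; _*_ to _*ℚ_)
import Data.Rational.Properties as ℚ
open import Data.Product using (_×_; _,_)
open import Data.Sum using (inj₁; inj₂)
open import Function using (_∘_)
open import Relation.Nullary.Decidable using (T?)
open import Relation.Binary.PropositionalEquality
open import Data.Rational.Solver using (module +-*-Solver)

ℕ→ℚ≡mkℚ : ∀ k → ℕ→ℚ k ≡ mkℚ (ℤ.+ k) 0 (Coprime.sym (Coprime.1-coprimeTo k))
ℕ→ℚ≡mkℚ k = ℚ.↥p/↧p≡p (mkℚ (ℤ.+ k) 0 (Coprime.sym (Coprime.1-coprimeTo k)))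

ℕ→ℚ-+ : ∀ m n → ℕ→ℚ (m + n) ≡ ℕ→ℚ m +ℚ ℕ→ℚ n
ℕ→ℚ-+ m n rewrite ℕ→ℚ≡mkℚ m | ℕ→ℚ≡mkℚ n =
  ℚ./-cong {p₁ = ℤ.+ (m + n)} {q₁ = 1} {q₂ = 1}
    (trans (ℤ.pos-+ m n) (cong₂ ℤ._+_ (sym (ℤ.*-identityʳ (ℤ.+ m))) (sym (ℤ.*-identityʳ (ℤ.+ n))))) refl

ℕ→ℚ-* : ∀ m n → ℕ→ℚ (m * n) ≡ ℕ→ℚ m *ℚ ℕ→ℚ n
ℕ→ℚ-* m n rewrite ℕ→ℚ≡mkℚ m | ℕ→ℚ≡mkℚ n =
  ℚ./-cong {p₁ = ℤ.+ (m * n)} {q₁ = 1} {p₂ = ℤ.+ m ℤ.* ℤ.+ n} {q₂ = 1} (ℤ.pos-* m n) refl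

ℕ→ℚ-*-1/ : ∀ n .{{_ : NonZero n}} → ℕ→ℚ n *ℚ (ℤ.+ 1 / n) ≡ 1ℚ
ℕ→ℚ-*-1/ (suc m) =
  trans (cong₂ _*ℚ_ (ℕ→ℚ≡mkℚ (suc m)) (ℚ.↥p/↧p≡p (mkℚ (ℤ.+ 1) m (Coprime.1-coprimeTo (suc m)))))
        (ℚ.*-inverseʳ (mkℚ (ℤ.+ suc m) 0 (Coprime.sym (Coprime.1-coprimeTo (suc m)))))

1/_! : ℕ → ℚ
1/ i ! = (ℤ.+ 1 / i !) {{i !≢0}}

!-*-1/! : ∀ i → ℕ→ℚ (i !) *ℚ 1/ i ! ≡ 1ℚ
!-*-1/! i = ℕ→ℚ-*-1/ (i !) {{i !≢0}}

suc-*-1/suc! : ∀ i → ℕ→ℚ (suc i) *ℚ 1/ suc i ! ≡ 1/ i !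
suc-*-1/suc! i = begin
  x *ℚ y                      ≡⟨ solve 2 (λ x y → x :* y := x :* y :* con 1ℚ) refl x y ⟩
  x *ℚ y *ℚ 1ℚ                ≡⟨ cong (x *ℚ y *ℚ_) (sym (!-*-1/! i)) ⟩
  x *ℚ y *ℚ (ℕ→ℚ (i !) *ℚ u)  ≡⟨ solve 4 (λ x y z u → x :* y :* (z :* u) := x :* z :* y :* u) refl x y (ℕ→ℚ (i !)) u ⟩
  x *ℚ ℕ→ℚ (i !) *ℚ y *ℚ u    ≡⟨ cong (λ z → z *ℚ y *ℚ u) (sym (ℕ→ℚ-* (suc i) (i !))) ⟩
  ℕ→ℚ (suc i !) *ℚ y *ℚ u     ≡⟨ cong (_*ℚ u) (!-*-1/! (suc i)) ⟩
  1ℚ *ℚ u                     ≡⟨ ℚ.*-identityˡ u ⟩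
  u                           ∎
  where
  open ≡-Reasoning
  open +-*-Solver
  x = ℕ→ℚ (suc i)
  y = 1/ suc i !
  u = 1/ i !

∑ : ℕ → (ℕ → ℚ) → ℚ
∑ zero    f = 0ℚ
∑ (suc n) f = f 0 +ℚ ∑ n (f ∘ suc)

infix 6.5 ∑
syntax ∑ n (λ i → e) = ∑[ i < n ] e

∑-cong : ∀ n {f g : ℕ → ℚ} → (∀ i → i < n → f i ≡ g i) → ∑ n f ≡ ∑ n g
∑-cong zero    f≡g = refl
∑-cong (suc n) f≡g = cong₂ _+ℚ_ (f≡g 0 (s≤s z≤n)) (∑-cong n (λ i i<n → f≡g (suc i) (s≤s i<n)))

∑-zero : ∀ n (f : ℕ → ℚ) → (∀ i → i < n → f i ≡ 0ℚ) → ∑ n f ≡ 0ℚ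
∑-zero zero    f f≡0 = refl
∑-zero (suc n) f f≡0 = begin
  f 0 +ℚ ∑ n (f ∘ suc) ≡⟨ cong₂ _+ℚ_ (f≡0 0 (s≤s z≤n)) (∑-zero n (f ∘ suc) (λ i i<n → f≡0 (suc i) (s≤s i<n))) ⟩
  0ℚ +ℚ 0ℚ             ≡⟨ ℚ.+-identityʳ 0ℚ ⟩
  0ℚ                   ∎
  where open ≡-Reasoning

∑-+ : ∀ n (f g : ℕ → ℚ) → ∑[ i < n ] (f i +ℚ g i) ≡ ∑ n f +ℚ ∑ n g
∑-+ zero    f g = sym (ℚ.+-identityʳ 0ℚ)
∑-+ (suc n) f g = trans (cong (f 0 +ℚ g 0 +ℚ_) (∑-+ n (f ∘ suc) (g ∘ suc)))
  (solve 4 (λ a b c d → (a :+ b) :+ (c :+ d) := (a :+ c) :+ (b :+ d)) refl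
     (f 0) (g 0) (∑ n (f ∘ suc)) (∑ n (g ∘ suc)))
  where open +-*-Solver

*-distribˡ-∑ : ∀ n x (f : ℕ → ℚ) → ∑[ i < n ] (x *ℚ f i) ≡ x *ℚ ∑ n f
*-distribˡ-∑ zero    x f = sym (ℚ.*-zeroʳ x)
*-distribˡ-∑ (suc n) x f = trans (cong (x *ℚ f 0 +ℚ_) (*-distribˡ-∑ n x (f ∘ suc)))
  (sym (ℚ.*-distribˡ-+ x (f 0) (∑ n (f ∘ suc))))

∑-init-last : ∀ n (f : ℕ → ℚ) → ∑ (suc n) f ≡ ∑ n f +ℚ f n
∑-init-last zero    f = trans (ℚ.+-identityʳ (f 0)) (sym (ℚ.+-identityˡ (f 0)))
∑-init-last (suc n) f = trans (cong (f 0 +ℚ_) (∑-init-last n (f ∘ suc)))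
  (sym (ℚ.+-assoc (f 0) (∑ n (f ∘ suc)) (f (suc n))))

∑-vanishing-tail : ∀ m k (f : ℕ → ℚ) → (∀ i → m ≤ i → i < m + k → f i ≡ 0ℚ) → ∑ (m + k) f ≡ ∑ m f
∑-vanishing-tail m zero    f tail≡0 = cong (λ n → ∑ n f) (ℕ.+-identityʳ m)
∑-vanishing-tail m (suc k) f tail≡0 = begin
  ∑ (m + suc k) f             ≡⟨ cong (λ n → ∑ n f) (ℕ.+-suc m k) ⟩
  ∑ (suc (m + k)) f           ≡⟨ ∑-init-last (m + k) f ⟩
  ∑ (m + k) f +ℚ f (m + k)    ≡⟨ cong₂ _+ℚ_ (∑-vanishing-tail m k f (λ i m≤i i<m+k → tail≡0 i m≤i (ℕ.<-trans i<m+k m+k<m+suc-k)))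
                                            (tail≡0 (m + k) (ℕ.m≤m+n m k) m+k<m+suc-k) ⟩
  ∑ m f +ℚ 0ℚ                 ≡⟨ ℚ.+-identityʳ (∑ m f) ⟩
  ∑ m f                       ∎
  where
  open ≡-Reasoning
  m+k<m+suc-k : m + k < m + suc k
  m+k<m+suc-k = ℕ.+-monoʳ-< m (ℕ.n<1+n k)

∑-comm : ∀ m n (f : ℕ → ℕ → ℚ) → ∑[ i < m ] ∑[ j < n ] f i j ≡ ∑[ j < n ] ∑[ i < m ] f i j
∑-comm zero    n f = sym (∑-zero n _ (λ _ _ → refl))
∑-comm (suc m) n f = trans (cong (∑ n (f 0) +ℚ_) (∑-comm m n (f ∘ suc)))
  (sym (∑-+ n (f 0) (λ j → ∑[ i < m ] f (suc i) j)))

Σℚ-map-applyUpTo : ∀ n (g : ℕ → ℕ) (f : ℕ → ℚ) → Σℚ (map f (applyUpTo g n)) ≡ ∑ n (f ∘ g)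
Σℚ-map-applyUpTo zero    g f = refl
Σℚ-map-applyUpTo (suc n) g f = cong (f (g 0) +ℚ_) (Σℚ-map-applyUpTo n (g ∘ suc) f)

Σℚ-map-range : ∀ lo n (f : ℕ → ℚ) → Σℚ (map f (map (lo +_) (upTo n))) ≡ ∑[ i < n ] f (lo + i)
Σℚ-map-range lo n f = trans (cong Σℚ (sym (List.map-∘ (upTo n)))) (Σℚ-map-applyUpTo n (λ i → i) (f ∘ (lo +_)))

sumWhere : {A : Set} → List A → (A → Bool) → (A → ℚ) → ℚ
sumWhere []       P W = 0ℚ
sumWhere (x ∷ xs) P W = (if P x then W x else 0ℚ) +ℚ sumWhere xs P W

module _ {A : Set} where

  Σℚ-map-filter : ∀ (xs : List A) P W → Σℚ (map W (filter (λ x → T? (P x)) xs)) ≡ sumWhere xs P W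
  Σℚ-map-filter []       P W = refl
  Σℚ-map-filter (x ∷ xs) P W with P x
  ... | true  = cong (W x +ℚ_) (Σℚ-map-filter xs P W)
  ... | false = trans (Σℚ-map-filter xs P W) (sym (ℚ.+-identityˡ _))

  sumWhere-++ : ∀ (xs ys : List A) P W → sumWhere (xs ++ ys) P W ≡ sumWhere xs P W +ℚ sumWhere ys P W
  sumWhere-++ []       ys P W = sym (ℚ.+-identityˡ _)
  sumWhere-++ (x ∷ xs) ys P W = trans (cong ((if P x then W x else 0ℚ) +ℚ_) (sumWhere-++ xs ys P W))
    (sym (ℚ.+-assoc (if P x then W x else 0ℚ) (sumWhere xs P W) (sumWhere ys P W)))

  sumWhere-concat : ∀ (xss : List (List A)) P W → sumWhere (concat xss) P W ≡ Σℚ (map (λ xs → sumWhere xs P W) xss)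
  sumWhere-concat []         P W = refl
  sumWhere-concat (xs ∷ xss) P W =
    trans (sumWhere-++ xs (concat xss) P W) (cong (sumWhere xs P W +ℚ_) (sumWhere-concat xss P W))

  sumWhere-cong : ∀ (xs : List A) {P Q : A → Bool} {V W : A → ℚ} →
                  (∀ x → P x ≡ Q x) → (∀ x → V x ≡ W x) → sumWhere xs P V ≡ sumWhere xs Q W
  sumWhere-cong []       P≡Q V≡W = refl
  sumWhere-cong (x ∷ xs) P≡Q V≡W =
    cong₂ _+ℚ_ (cong₂ (λ b w → if b then w else 0ℚ) (P≡Q x) (V≡W x)) (sumWhere-cong xs P≡Q V≡W)

  *-distribˡ-sumWhere : ∀ (xs : List A) P y W → sumWhere xs P (λ x → y *ℚ W x) ≡ y *ℚ sumWhere xs P W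
  *-distribˡ-sumWhere []       P y W = sym (ℚ.*-zeroʳ y)
  *-distribˡ-sumWhere (x ∷ xs) P y W with P x
  ... | true  = trans (cong (y *ℚ W x +ℚ_) (*-distribˡ-sumWhere xs P y W)) (sym (ℚ.*-distribˡ-+ y (W x) (sumWhere xs P W)))
  ... | false = trans (ℚ.+-identityˡ _)
                  (trans (*-distribˡ-sumWhere xs P y W) (cong (y *ℚ_) (sym (ℚ.+-identityˡ (sumWhere xs P W)))))

  sumWhere-none : ∀ (xs : List A) P W → (∀ x → P x ≡ false) → sumWhere xs P W ≡ 0ℚ
  sumWhere-none []       P W P≡false = refl
  sumWhere-none (x ∷ xs) P W P≡false rewrite P≡false x = trans (ℚ.+-identityˡ _) (sumWhere-none xs P W P≡false)

  module _ {B : Set} where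

    sumWhere-map : ∀ (h : B → A) xs P W → sumWhere (map h xs) P W ≡ sumWhere xs (P ∘ h) (W ∘ h)
    sumWhere-map h []       P W = refl
    sumWhere-map h (x ∷ xs) P W = cong ((if P (h x) then W (h x) else 0ℚ) +ℚ_) (sumWhere-map h xs P W)

    sumWhere-concatMap : ∀ (g : B → List A) xs P W → sumWhere (concatMap g xs) P W ≡ Σℚ (map (λ x → sumWhere (g x) P W) xs)
    sumWhere-concatMap g xs P W = trans (sumWhere-concat (map g xs) P W) (cong Σℚ (sym (List.map-∘ xs)))

tupleSum : ℕ → ℕ → (List ℕ → Bool) → (List ℕ → ℚ) → ℚ
tupleSum b M P W = ∑[ m < suc M ] sumWhere (tuples m b) P W

sumWhere-tuples-suc : ∀ m b P W →
  sumWhere (tuples (suc m) b) P W ≡ ∑[ k < suc b ] sumWhere (tuples m b) (P ∘ (k ∷_)) (W ∘ (k ∷_))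
sumWhere-tuples-suc m b P W = begin
  sumWhere (tuples (suc m) b) P W
    ≡⟨ sumWhere-concatMap (λ k → map (k ∷_) (tuples m b)) (upTo (suc b)) P W ⟩
  Σℚ (map (λ k → sumWhere (map (k ∷_) (tuples m b)) P W) (upTo (suc b)))
    ≡⟨ Σℚ-map-applyUpTo (suc b) (λ k → k) (λ k → sumWhere (map (k ∷_) (tuples m b)) P W) ⟩
  ∑[ k < suc b ] sumWhere (map (k ∷_) (tuples m b)) P W
    ≡⟨ ∑-cong (suc b) (λ k _ → sumWhere-map (k ∷_) (tuples m b) P W) ⟩
  ∑[ k < suc b ] sumWhere (tuples m b) (P ∘ (k ∷_)) (W ∘ (k ∷_)) ∎
  where open ≡-Reasoning

tupleSum-suc : ∀ b M P W →
  tupleSum b (suc M) P W ≡ (if P [] then W [] else 0ℚ) +ℚ ∑[ k < suc b ] tupleSum b M (P ∘ (k ∷_)) (W ∘ (k ∷_))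
tupleSum-suc b M P W = begin
  sumWhere (tuples 0 b) P W +ℚ ∑[ m < suc M ] sumWhere (tuples (suc m) b) P W
    ≡⟨ cong₂ _+ℚ_ (ℚ.+-identityʳ (if P [] then W [] else 0ℚ)) (∑-cong (suc M) (λ m _ → sumWhere-tuples-suc m b P W)) ⟩
  (if P [] then W [] else 0ℚ) +ℚ ∑[ m < suc M ] ∑[ k < suc b ] sumWhere (tuples m b) (P ∘ (k ∷_)) (W ∘ (k ∷_))
    ≡⟨ cong ((if P [] then W [] else 0ℚ) +ℚ_)
            (∑-comm (suc M) (suc b) (λ m k → sumWhere (tuples m b) (P ∘ (k ∷_)) (W ∘ (k ∷_)))) ⟩
  (if P [] then W [] else 0ℚ) +ℚ ∑[ k < suc b ] tupleSum b M (P ∘ (k ∷_)) (W ∘ (k ∷_)) ∎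
  where open ≡-Reasoning

-- The sum over the compositions (q₁, …, q_j) of p into j positive parts of 1 / (q₁! ⋯ q_j!),
-- that is j! S(p, j) / p! for the Stirling number S(p, j) of the second kind.
compositionSum : ℕ → ℕ → ℚ
compositionSum p       (suc j) = ∑[ i < p ] 1/ suc i ! *ℚ compositionSum (p ∸ suc i) j
compositionSum zero    zero    = 1ℚ
compositionSum (suc p) zero    = 0ℚ

compositionSum-< : ∀ {p j} → p < j → compositionSum p j ≡ 0ℚ
compositionSum-< {zero}  {suc j} _         = refl
compositionSum-< {suc p} {suc j} (s≤s p<j) = ∑-zero (suc p) _ λ i _ →
  trans (cong (1/ suc i ! *ℚ_) (compositionSum-< (ℕ.≤-<-trans (ℕ.m∸n≤m p i) p<j))) (ℚ.*-zeroʳ (1/ suc i !))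

private
  a = compositionSum

-- Marking one of the p + 1 elements: it either forms a block by itself or joins one of the j + 1 blocks.
mutual
  compositionSum-suc-suc : ∀ j p → ℕ→ℚ (suc p) *ℚ a (suc p) (suc j) ≡ ℕ→ℚ (suc j) *ℚ (a p (suc j) +ℚ a p j)
  compositionSum-suc-suc j p = begin
    ℕ→ℚ (suc p) *ℚ (∑[ i < suc p ] 1/ suc i ! *ℚ a (p ∸ i) j)
      ≡⟨ sym (*-distribˡ-∑ (suc p) (ℕ→ℚ (suc p)) (λ i → 1/ suc i ! *ℚ a (p ∸ i) j)) ⟩
    ∑[ i < suc p ] (ℕ→ℚ (suc p) *ℚ (1/ suc i ! *ℚ a (p ∸ i) j))
      ≡⟨ ∑-cong (suc p) (λ i i<1+p → split i (ℕ.≤-pred i<1+p)) ⟩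
    ∑[ i < suc p ] (1/ i ! *ℚ a (p ∸ i) j +ℚ 1/ suc i ! *ℚ (ℕ→ℚ (p ∸ i) *ℚ a (p ∸ i) j))
      ≡⟨ ∑-+ (suc p) (λ i → 1/ i ! *ℚ a (p ∸ i) j) (λ i → 1/ suc i ! *ℚ (ℕ→ℚ (p ∸ i) *ℚ a (p ∸ i) j)) ⟩
    (1/ 0 ! *ℚ a p j +ℚ a p (suc j)) +ℚ ∑[ i < suc p ] 1/ suc i ! *ℚ (ℕ→ℚ (p ∸ i) *ℚ a (p ∸ i) j)
      ≡⟨ cong₂ (λ x y → (x +ℚ a p (suc j)) +ℚ y) (ℚ.*-identityˡ (a p j)) (weightedCompositionSum j p) ⟩
    (a p j +ℚ a p (suc j)) +ℚ ℕ→ℚ j *ℚ (a p (suc j) +ℚ a p j)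
      ≡⟨ solve 3 (λ x y k → (x :+ y) :+ k :* (y :+ x) := (con 1ℚ :+ k) :* (y :+ x)) refl (a p j) (a p (suc j)) (ℕ→ℚ j) ⟩
    (1ℚ +ℚ ℕ→ℚ j) *ℚ (a p (suc j) +ℚ a p j)
      ≡⟨ cong (_*ℚ (a p (suc j) +ℚ a p j)) (sym (ℕ→ℚ-+ 1 j)) ⟩
    ℕ→ℚ (suc j) *ℚ (a p (suc j) +ℚ a p j) ∎
    where
    open ≡-Reasoning
    open +-*-Solver
    split : ∀ i → i ≤ p → ℕ→ℚ (suc p) *ℚ (1/ suc i ! *ℚ a (p ∸ i) j)
                         ≡ 1/ i ! *ℚ a (p ∸ i) j +ℚ 1/ suc i ! *ℚ (ℕ→ℚ (p ∸ i) *ℚ a (p ∸ i) j)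
    split i i≤p = begin
      ℕ→ℚ (suc p) *ℚ (w *ℚ x)
        ≡⟨ cong (λ n → ℕ→ℚ (suc n) *ℚ (w *ℚ x)) (sym (ℕ.m+[n∸m]≡n i≤p)) ⟩
      ℕ→ℚ (suc i + (p ∸ i)) *ℚ (w *ℚ x)
        ≡⟨ cong (_*ℚ (w *ℚ x)) (ℕ→ℚ-+ (suc i) (p ∸ i)) ⟩
      (ℕ→ℚ (suc i) +ℚ ℕ→ℚ (p ∸ i)) *ℚ (w *ℚ x)
        ≡⟨ solve 4 (λ s t w x → (s :+ t) :* (w :* x) := (s :* w) :* x :+ w :* (t :* x)) refl (ℕ→ℚ (suc i)) (ℕ→ℚ (p ∸ i)) w x ⟩
      (ℕ→ℚ (suc i) *ℚ w) *ℚ x +ℚ w *ℚ (ℕ→ℚ (p ∸ i) *ℚ x)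
        ≡⟨ cong (λ v → v *ℚ x +ℚ w *ℚ (ℕ→ℚ (p ∸ i) *ℚ x)) (suc-*-1/suc! i) ⟩
      1/ i ! *ℚ x +ℚ w *ℚ (ℕ→ℚ (p ∸ i) *ℚ x) ∎
      where
      w = 1/ suc i !
      x = a (p ∸ i) j

  weightedCompositionSum : ∀ j p → ∑[ i < suc p ] 1/ suc i ! *ℚ (ℕ→ℚ (p ∸ i) *ℚ a (p ∸ i) j)
                                   ≡ ℕ→ℚ j *ℚ (a p (suc j) +ℚ a p j)
  weightedCompositionSum j p = begin
    ∑[ i < suc p ] g i                 ≡⟨ ∑-init-last p g ⟩
    ∑[ i < p ] g i +ℚ g p              ≡⟨ cong (∑[ i < p ] g i +ℚ_) last≡0 ⟩
    ∑[ i < p ] g i +ℚ 0ℚ               ≡⟨ ℚ.+-identityʳ _ ⟩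
    ∑[ i < p ] g i                     ≡⟨ ∑-cong p (λ i i<p → cong (λ n → 1/ suc i ! *ℚ (ℕ→ℚ n *ℚ a n j)) (ℕ.+-∸-assoc 1 i<p)) ⟩
    ∑[ i < p ] 1/ suc i ! *ℚ (ℕ→ℚ (suc (p ∸ suc i)) *ℚ a (suc (p ∸ suc i)) j) ≡⟨ innerSum j ⟩
    ℕ→ℚ j *ℚ (a p (suc j) +ℚ a p j)  ∎
    where
    open ≡-Reasoning
    open +-*-Solver
    g : ℕ → ℚ
    g i = 1/ suc i ! *ℚ (ℕ→ℚ (p ∸ i) *ℚ a (p ∸ i) j)
    last≡0 : g p ≡ 0ℚ
    last≡0 = begin
      1/ suc p ! *ℚ (ℕ→ℚ (p ∸ p) *ℚ a (p ∸ p) j) ≡⟨ cong (λ n → 1/ suc p ! *ℚ (ℕ→ℚ n *ℚ a n j)) (ℕ.n∸n≡0 p) ⟩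
      1/ suc p ! *ℚ (0ℚ *ℚ a 0 j)                ≡⟨ cong (1/ suc p ! *ℚ_) (ℚ.*-zeroˡ (a 0 j)) ⟩
      1/ suc p ! *ℚ 0ℚ                           ≡⟨ ℚ.*-zeroʳ (1/ suc p !) ⟩
      0ℚ                                         ∎
    innerSum : ∀ j → ∑[ i < p ] 1/ suc i ! *ℚ (ℕ→ℚ (suc (p ∸ suc i)) *ℚ a (suc (p ∸ suc i)) j)
                 ≡ ℕ→ℚ j *ℚ (a p (suc j) +ℚ a p j)
    innerSum zero = begin
      ∑[ i < p ] 1/ suc i ! *ℚ (ℕ→ℚ (suc (p ∸ suc i)) *ℚ 0ℚ)
        ≡⟨ ∑-zero p _ (λ i _ → trans (cong (1/ suc i ! *ℚ_) (ℚ.*-zeroʳ (ℕ→ℚ (suc (p ∸ suc i))))) (ℚ.*-zeroʳ (1/ suc i !))) ⟩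
      0ℚ ≡⟨ sym (ℚ.*-zeroˡ (a p 1 +ℚ a p 0)) ⟩
      0ℚ *ℚ (a p 1 +ℚ a p 0) ∎
    innerSum (suc j′) = begin
      ∑[ i < p ] 1/ suc i ! *ℚ (ℕ→ℚ (suc (q i)) *ℚ a (suc (q i)) (suc j′))
        ≡⟨ ∑-cong p (λ i _ → cong (1/ suc i ! *ℚ_) (compositionSum-suc-suc j′ (q i))) ⟩
      ∑[ i < p ] 1/ suc i ! *ℚ (ℕ→ℚ (suc j′) *ℚ (a (q i) (suc j′) +ℚ a (q i) j′))
        ≡⟨ ∑-cong p (λ i _ → solve 4 (λ w k x y → w :* (k :* (x :+ y)) := k :* (w :* x :+ w :* y)) refl
                                 (1/ suc i !) (ℕ→ℚ (suc j′)) (a (q i) (suc j′)) (a (q i) j′)) ⟩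
      ∑[ i < p ] ℕ→ℚ (suc j′) *ℚ (1/ suc i ! *ℚ a (q i) (suc j′) +ℚ 1/ suc i ! *ℚ a (q i) j′)
        ≡⟨ *-distribˡ-∑ p (ℕ→ℚ (suc j′)) _ ⟩
      ℕ→ℚ (suc j′) *ℚ (∑[ i < p ] (1/ suc i ! *ℚ a (q i) (suc j′) +ℚ 1/ suc i ! *ℚ a (q i) j′))
        ≡⟨ cong (ℕ→ℚ (suc j′) *ℚ_) (∑-+ p (λ i → 1/ suc i ! *ℚ a (q i) (suc j′)) (λ i → 1/ suc i ! *ℚ a (q i) j′)) ⟩
      ℕ→ℚ (suc j′) *ℚ (a p (suc (suc j′)) +ℚ a p (suc j′)) ∎
      where
      q : ℕ → ℕ
      q i = p ∸ suc i

compositionSum-suc-bounded : ∀ ℓ z → ∑[ i < suc ℓ ] 1/ suc i ! *ℚ a (ℓ + z ∸ i) z ≡ a (suc (ℓ + z)) (suc z)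
compositionSum-suc-bounded ℓ z = sym (∑-vanishing-tail (suc ℓ) z f λ i ℓ<i i<1+ℓ+z →
  trans (cong (1/ suc i ! *ℚ_) (compositionSum-< (ℓ+z∸i<z i ℓ<i i<1+ℓ+z))) (ℚ.*-zeroʳ (1/ suc i !)))
  where
  f : ℕ → ℚ
  f i = 1/ suc i ! *ℚ a (ℓ + z ∸ i) z
  ℓ+z∸i<z : ∀ i → ℓ < i → i < suc (ℓ + z) → ℓ + z ∸ i < z
  ℓ+z∸i<z i ℓ<i (s≤s i≤ℓ+z) = ℕ.+-cancelˡ-< i (ℓ + z ∸ i) z (begin-strict
    i + (ℓ + z ∸ i) ≡⟨ ℕ.m+[n∸m]≡n i≤ℓ+z ⟩
    ℓ + z           <⟨ ℕ.+-monoˡ-< z ℓ<i ⟩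
    i + z           ∎)
    where open ℕ.≤-Reasoning

module _ (b M : ℕ) where

  tupleSum-cong : ∀ {P Q} W → (∀ ks → P ks ≡ Q ks) → tupleSum b M P W ≡ tupleSum b M Q W
  tupleSum-cong W P≡Q = ∑-cong (suc M) (λ m _ → sumWhere-cong (tuples m b) {V = W} P≡Q (λ _ → refl))

  *-distribˡ-tupleSum : ∀ P y W → tupleSum b M P (λ ks → y *ℚ W ks) ≡ y *ℚ tupleSum b M P W
  *-distribˡ-tupleSum P y W =
    trans (∑-cong (suc M) (λ m _ → *-distribˡ-sumWhere (tuples m b) P y W))
          (*-distribˡ-∑ (suc M) y (λ m → sumWhere (tuples m b) P W))

  tupleSum-none : ∀ P W → (∀ ks → P ks ≡ false) → tupleSum b M P W ≡ 0ℚ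
  tupleSum-none P W P≡false = ∑-zero (suc M) _ (λ m _ → sumWhere-none (tuples m b) P W P≡false)

zeroCount : List ℕ → ℕ
zeroCount []           = 0
zeroCount (zero  ∷ ks) = suc (zeroCount ks)
zeroCount (suc _ ∷ ks) = zeroCount ks

headIsZeroIf : Bool → List ℕ → Bool
headIsZeroIf false _       = true
headIsZeroIf true  []      = true
headIsZeroIf true  (k ∷ _) = k ≡ᵇ 0

-- The flag records whether the entry just before the tuple was positive.
hasShape : ℕ → ℕ → Bool → List ℕ → Bool
hasShape ℓ z after ks =
  (content ks ≡ᵇ ℓ) ∧ ((zeroCount ks ≡ᵇ z) ∧ (headIsZeroIf after ks ∧ noAdjacent ks))

weight : List ℕ → ℚ
weight ks = Πℚ (map (λ k → 1/ suc k !) ks)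

+-≡ᵇ-≤ : ∀ m n ℓ → m ≤ ℓ → (m + n ≡ᵇ ℓ) ≡ (n ≡ᵇ ℓ ∸ m)
+-≡ᵇ-≤ zero    n ℓ       _         = refl
+-≡ᵇ-≤ (suc m) n (suc ℓ) (s≤s m≤ℓ) = +-≡ᵇ-≤ m n ℓ m≤ℓ

+-≡ᵇ-> : ∀ m n ℓ → ℓ < m → (m + n ≡ᵇ ℓ) ≡ false
+-≡ᵇ-> (suc m) n zero    _         = refl
+-≡ᵇ-> (suc m) n (suc ℓ) (s≤s ℓ<m) = +-≡ᵇ-> m n ℓ ℓ<m

hasShape-zero∷ : ∀ ℓ z after ks → hasShape ℓ (suc z) after (0 ∷ ks) ≡ hasShape ℓ z false ks
hasShape-zero∷ ℓ z false []      = refl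
hasShape-zero∷ ℓ z false (_ ∷ _) = refl
hasShape-zero∷ ℓ z true  []      = refl
hasShape-zero∷ ℓ z true  (_ ∷ _) = refl

hasShape-zero∷-no-zeros : ∀ ℓ after ks → hasShape ℓ 0 after (0 ∷ ks) ≡ false
hasShape-zero∷-no-zeros ℓ after ks = ∧-zeroʳ _

hasShape-afterPositive-suc∷ : ∀ ℓ z k ks → hasShape ℓ z true (suc k ∷ ks) ≡ false
hasShape-afterPositive-suc∷ ℓ z k ks = trans (cong ((content (suc k ∷ ks) ≡ᵇ ℓ) ∧_) (∧-zeroʳ _)) (∧-zeroʳ _)

hasShape-suc∷-≤ : ∀ ℓ z k ks → suc k ≤ ℓ → hasShape ℓ z false (suc k ∷ ks) ≡ hasShape (ℓ ∸ suc k) z true ks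
hasShape-suc∷-≤ ℓ z k []       k<ℓ = cong (_∧ ((0 ≡ᵇ z) ∧ true)) (+-≡ᵇ-≤ (suc k) 0 ℓ k<ℓ)
hasShape-suc∷-≤ ℓ z k (l ∷ ks) k<ℓ =
  cong (_∧ ((zeroCount (l ∷ ks) ≡ᵇ z) ∧ ((l ≡ᵇ 0) ∧ noAdjacent (l ∷ ks)))) (+-≡ᵇ-≤ (suc k) (content (l ∷ ks)) ℓ k<ℓ)

hasShape-suc∷-> : ∀ ℓ z k ks → ℓ < suc k → hasShape ℓ z false (suc k ∷ ks) ≡ false
hasShape-suc∷-> ℓ z k ks ℓ≤k =
  cong (_∧ ((zeroCount ks ≡ᵇ z) ∧ noAdjacent (suc k ∷ ks))) (+-≡ᵇ-> (suc k) (content ks) ℓ ℓ≤k)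

module ShapeSum (b : ℕ) where

  shapeSum : ℕ → Bool → ℕ → ℕ → ℚ
  shapeSum M after ℓ z = tupleSum b M (hasShape ℓ z after) weight

  emptyTerm : Bool → ℕ → ℕ → ℚ
  emptyTerm after ℓ z = if hasShape ℓ z after [] then 1ℚ else 0ℚ

  zeroHeadSum : ℕ → Bool → ℕ → ℕ → ℚ
  zeroHeadSum M after ℓ z = tupleSum b M (λ ks → hasShape ℓ z after (0 ∷ ks)) (λ ks → 1/ 1 ! *ℚ weight ks)

  positiveHeadSum : ℕ → Bool → ℕ → ℕ → ℕ → ℚ
  positiveHeadSum M after ℓ z k =
    tupleSum b M (λ ks → hasShape ℓ z after (suc k ∷ ks)) (λ ks → 1/ suc (suc k) ! *ℚ weight ks)

  shapeSum-suc : ∀ M after ℓ z → shapeSum (suc M) after ℓ z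
    ≡ (emptyTerm after ℓ z +ℚ zeroHeadSum M after ℓ z) +ℚ ∑[ k < b ] positiveHeadSum M after ℓ z k
  shapeSum-suc M after ℓ z = trans (tupleSum-suc b M (hasShape ℓ z after) weight)
    (sym (ℚ.+-assoc (emptyTerm after ℓ z) (zeroHeadSum M after ℓ z) (∑[ k < b ] positiveHeadSum M after ℓ z k)))

  zeroHeadSum-suc : ∀ M after ℓ z → zeroHeadSum M after ℓ (suc z) ≡ shapeSum M false ℓ z
  zeroHeadSum-suc M after ℓ z = begin
    zeroHeadSum M after ℓ (suc z)
      ≡⟨ *-distribˡ-tupleSum b M (λ ks → hasShape ℓ (suc z) after (0 ∷ ks)) (1/ 1 !) weight ⟩
    1/ 1 ! *ℚ tupleSum b M (λ ks → hasShape ℓ (suc z) after (0 ∷ ks)) weight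
      ≡⟨ ℚ.*-identityˡ _ ⟩
    tupleSum b M (λ ks → hasShape ℓ (suc z) after (0 ∷ ks)) weight
      ≡⟨ tupleSum-cong b M weight (hasShape-zero∷ ℓ z after) ⟩
    shapeSum M false ℓ z ∎
    where open ≡-Reasoning

  zeroHeadSum-zero : ∀ M after ℓ → zeroHeadSum M after ℓ 0 ≡ 0ℚ
  zeroHeadSum-zero M after ℓ = tupleSum-none b M (λ ks → hasShape ℓ 0 after (0 ∷ ks)) _ (hasShape-zero∷-no-zeros ℓ after)

  positiveHeadSum-afterPositive : ∀ M ℓ z k → positiveHeadSum M true ℓ z k ≡ 0ℚ
  positiveHeadSum-afterPositive M ℓ z k =
    tupleSum-none b M (λ ks → hasShape ℓ z true (suc k ∷ ks)) _ (hasShape-afterPositive-suc∷ ℓ z k)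

  positiveHeadSum-> : ∀ M ℓ z k → ℓ < suc k → positiveHeadSum M false ℓ z k ≡ 0ℚ
  positiveHeadSum-> M ℓ z k ℓ≤k =
    tupleSum-none b M (λ ks → hasShape ℓ z false (suc k ∷ ks)) _ (λ ks → hasShape-suc∷-> ℓ z k ks ℓ≤k)

  positiveHeadSum-≤ : ∀ M ℓ z k → suc k ≤ ℓ →
    positiveHeadSum M false ℓ z k ≡ 1/ suc (suc k) ! *ℚ shapeSum M true (ℓ ∸ suc k) z
  positiveHeadSum-≤ M ℓ z k k<ℓ =
    trans (*-distribˡ-tupleSum b M (λ ks → hasShape ℓ z false (suc k ∷ ks)) (1/ suc (suc k) !) weight)
    (cong (1/ suc (suc k) ! *ℚ_) (tupleSum-cong b M weight (λ ks → hasShape-suc∷-≤ ℓ z k ks k<ℓ)))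

  emptyTerm-zero : ∀ after ℓ → emptyTerm after ℓ 0 ≡ a ℓ 0
  emptyTerm-zero false zero    = refl
  emptyTerm-zero false (suc ℓ) = refl
  emptyTerm-zero true  zero    = refl
  emptyTerm-zero true  (suc ℓ) = refl

  emptyTerm-suc : ∀ after ℓ z → emptyTerm after ℓ (suc z) ≡ 0ℚ
  emptyTerm-suc false zero    z = refl
  emptyTerm-suc false (suc ℓ) z = refl
  emptyTerm-suc true  zero    z = refl
  emptyTerm-suc true  (suc ℓ) z = refl

  emptyOrZeroHead : ∀ M after ℓ z →
    (∀ {z′} → z ≡ suc z′ → shapeSum M false ℓ z′ ≡ a (suc (ℓ + z′)) (suc z′)) →
    emptyTerm after ℓ z +ℚ zeroHeadSum M after ℓ z ≡ a (ℓ + z) z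
  emptyOrZeroHead M after ℓ zero _ = begin
    emptyTerm after ℓ 0 +ℚ zeroHeadSum M after ℓ 0 ≡⟨ cong₂ _+ℚ_ (emptyTerm-zero after ℓ) (zeroHeadSum-zero M after ℓ) ⟩
    a ℓ 0 +ℚ 0ℚ                                    ≡⟨ ℚ.+-identityʳ (a ℓ 0) ⟩
    a ℓ 0                                          ≡⟨ cong (λ n → a n 0) (sym (ℕ.+-identityʳ ℓ)) ⟩
    a (ℓ + 0) 0                                    ∎
    where open ≡-Reasoning
  emptyOrZeroHead M after ℓ (suc z) free = begin
    emptyTerm after ℓ (suc z) +ℚ zeroHeadSum M after ℓ (suc z) ≡⟨ cong₂ _+ℚ_ (emptyTerm-suc after ℓ z) (zeroHeadSum-suc M after ℓ z) ⟩
    0ℚ +ℚ shapeSum M false ℓ z                                 ≡⟨ ℚ.+-identityˡ _ ⟩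
    shapeSum M false ℓ z                                       ≡⟨ free refl ⟩
    a (suc (ℓ + z)) (suc z)                                    ≡⟨ cong (λ n → a n (suc z)) (sym (ℕ.+-suc ℓ z)) ⟩
    a (ℓ + suc z) (suc z)                                      ∎
    where open ≡-Reasoning

  ∸-suc-+-≤ : ∀ {ℓ z M k} → ℓ + z ≤ suc M → k < ℓ → ℓ ∸ suc k + z ≤ M
  ∸-suc-+-≤ {ℓ} {z} {M} {k} ℓ+z≤1+M k<ℓ = begin
    ℓ ∸ suc k + z ≡⟨ ℕ.+-∸-comm z k<ℓ ⟨
    ℓ + z ∸ suc k ≤⟨ ℕ.∸-monoˡ-≤ (suc k) ℓ+z≤1+M ⟩
    M ∸ k         ≤⟨ ℕ.m∸n≤m M k ⟩
    M             ∎
    where open ℕ.≤-Reasoning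

  mutual
    shapeSum-afterPositive : ∀ M ℓ z → ℓ ≤ b → ℓ + z ≤ M → shapeSum M true ℓ z ≡ a (ℓ + z) z
    shapeSum-afterPositive zero    zero zero _   _       = refl
    shapeSum-afterPositive (suc M) ℓ    z    ℓ≤b ℓ+z≤1+M = begin
      shapeSum (suc M) true ℓ z
        ≡⟨ shapeSum-suc M true ℓ z ⟩
      (emptyTerm true ℓ z +ℚ zeroHeadSum M true ℓ z) +ℚ ∑[ k < b ] positiveHeadSum M true ℓ z k
        ≡⟨ cong₂ _+ℚ_ (emptyOrZeroHead M true ℓ z (shapeSum-free-pred M ℓ z ℓ≤b ℓ+z≤1+M))
                      (∑-zero b _ (λ k _ → positiveHeadSum-afterPositive M ℓ z k)) ⟩
      a (ℓ + z) z +ℚ 0ℚ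
        ≡⟨ ℚ.+-identityʳ _ ⟩
      a (ℓ + z) z ∎
      where open ≡-Reasoning

    shapeSum-free : ∀ M ℓ z → ℓ ≤ b → ℓ + z ≤ M → shapeSum M false ℓ z ≡ a (suc (ℓ + z)) (suc z)
    shapeSum-free zero    zero zero _   _       = refl
    shapeSum-free (suc M) ℓ    z    ℓ≤b ℓ+z≤1+M = begin
      shapeSum (suc M) false ℓ z
        ≡⟨ shapeSum-suc M false ℓ z ⟩
      (emptyTerm false ℓ z +ℚ zeroHeadSum M false ℓ z) +ℚ ∑[ k < b ] positiveHeadSum M false ℓ z k
        ≡⟨ cong₂ _+ℚ_ (emptyOrZeroHead M false ℓ z (shapeSum-free-pred M ℓ z ℓ≤b ℓ+z≤1+M))
                      (positiveHeads M ℓ z ℓ≤b ℓ+z≤1+M) ⟩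
      a (ℓ + z) z +ℚ ∑[ k < ℓ ] 1/ suc (suc k) ! *ℚ a (ℓ + z ∸ suc k) z
        ≡⟨ cong (_+ℚ ∑[ k < ℓ ] 1/ suc (suc k) ! *ℚ a (ℓ + z ∸ suc k) z) (sym (ℚ.*-identityˡ (a (ℓ + z) z))) ⟩
      ∑[ i < suc ℓ ] 1/ suc i ! *ℚ a (ℓ + z ∸ i) z
        ≡⟨ compositionSum-suc-bounded ℓ z ⟩
      a (suc (ℓ + z)) (suc z) ∎
      where open ≡-Reasoning

    shapeSum-free-pred : ∀ M ℓ z → ℓ ≤ b → ℓ + z ≤ suc M →
      ∀ {z′} → z ≡ suc z′ → shapeSum M false ℓ z′ ≡ a (suc (ℓ + z′)) (suc z′)
    shapeSum-free-pred M ℓ z ℓ≤b ℓ+z≤1+M refl = shapeSum-free M ℓ _ ℓ≤b (ℕ.≤-pred (subst (_≤ suc M) (ℕ.+-suc ℓ _) ℓ+z≤1+M))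

    positiveHeads : ∀ M ℓ z → ℓ ≤ b → ℓ + z ≤ suc M →
      ∑[ k < b ] positiveHeadSum M false ℓ z k ≡ ∑[ k < ℓ ] 1/ suc (suc k) ! *ℚ a (ℓ + z ∸ suc k) z
    positiveHeads M ℓ z ℓ≤b ℓ+z≤1+M = begin
      ∑[ k < b ] positiveHeadSum M false ℓ z k
        ≡⟨ cong (λ n → ∑[ k < n ] positiveHeadSum M false ℓ z k) (sym (ℕ.m+[n∸m]≡n ℓ≤b)) ⟩
      ∑[ k < ℓ + (b ∸ ℓ) ] positiveHeadSum M false ℓ z k
        ≡⟨ ∑-vanishing-tail ℓ (b ∸ ℓ) _ (λ k ℓ≤k _ → positiveHeadSum-> M ℓ z k (s≤s ℓ≤k)) ⟩
      ∑[ k < ℓ ] positiveHeadSum M false ℓ z k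
        ≡⟨ ∑-cong ℓ head ⟩
      ∑[ k < ℓ ] 1/ suc (suc k) ! *ℚ a (ℓ + z ∸ suc k) z ∎
      where
      open ≡-Reasoning
      head : ∀ k → k < ℓ → positiveHeadSum M false ℓ z k ≡ 1/ suc (suc k) ! *ℚ a (ℓ + z ∸ suc k) z
      head k k<ℓ = begin
        positiveHeadSum M false ℓ z k
          ≡⟨ positiveHeadSum-≤ M ℓ z k k<ℓ ⟩
        1/ suc (suc k) ! *ℚ shapeSum M true (ℓ ∸ suc k) z
          ≡⟨ cong (1/ suc (suc k) ! *ℚ_) (shapeSum-afterPositive M (ℓ ∸ suc k) z
                   (ℕ.≤-trans (ℕ.m∸n≤m ℓ (suc k)) ℓ≤b) (∸-suc-+-≤ ℓ+z≤1+M k<ℓ)) ⟩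
        1/ suc (suc k) ! *ℚ a (ℓ ∸ suc k + z) z
          ≡⟨ cong (λ n → 1/ suc (suc k) ! *ℚ a n z) (ℕ.+-∸-comm z k<ℓ) ⟨
        1/ suc (suc k) ! *ℚ a (ℓ + z ∸ suc k) z ∎

open ShapeSum using (shapeSum-free)

+-≡ᵇ-cancelˡ : ∀ s m n → (s + m ≡ᵇ s + n) ≡ (m ≡ᵇ n)
+-≡ᵇ-cancelˡ zero    m n = refl
+-≡ᵇ-cancelˡ (suc s) m n = +-≡ᵇ-cancelˡ s m n

≡ᵇ-sym : ∀ m n → (m ≡ᵇ n) ≡ (n ≡ᵇ m)
≡ᵇ-sym zero    zero    = refl
≡ᵇ-sym zero    (suc n) = refl
≡ᵇ-sym (suc m) zero    = refl
≡ᵇ-sym (suc m) (suc n) = ≡ᵇ-sym m n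

length≡support+zeroCount : ∀ ks → length ks ≡ support ks + zeroCount ks
length≡support+zeroCount []           = refl
length≡support+zeroCount (zero  ∷ ks) =
  trans (cong suc (length≡support+zeroCount ks)) (sym (ℕ.+-suc (support ks) (zeroCount ks)))
length≡support+zeroCount (suc _ ∷ ks) = cong suc (length≡support+zeroCount ks)

-- As length = support + zeroCount, the support condition of admissible fixes the number of zeros.
admissible≡hasShape : ∀ ℓ z ks → admissible (suc (ℓ + z)) ℓ ks ≡ hasShape ℓ z false ks
admissible≡hasShape ℓ z ks = cong (λ b → (content ks ≡ᵇ ℓ) ∧ (b ∧ noAdjacent ks)) (begin
  (s + suc (ℓ + z) ≡ᵇ length ks + ℓ + 1)        ≡⟨ cong (s + suc (ℓ + z) ≡ᵇ_) length+ℓ+1 ⟩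
  (s + suc (ℓ + z) ≡ᵇ s + suc (ℓ + zeroCount ks)) ≡⟨ trans (+-≡ᵇ-cancelˡ s _ _) (+-≡ᵇ-cancelˡ ℓ z (zeroCount ks)) ⟩
  (z ≡ᵇ zeroCount ks)                            ≡⟨ ≡ᵇ-sym z (zeroCount ks) ⟩
  (zeroCount ks ≡ᵇ z)                            ∎)
  where
  open ≡-Reasoning
  s = support ks
  length+ℓ+1 : length ks + ℓ + 1 ≡ s + suc (ℓ + zeroCount ks)
  length+ℓ+1 = trans (cong (λ n → n + ℓ + 1) (length≡support+zeroCount ks))
                     (solve 3 (λ s z ℓ → s :+ z :+ ℓ :+ con 1 := s :+ (con 1 :+ (ℓ :+ z))) refl s (zeroCount ks) ℓ)
    where open ℕ-Solver.+-*-Solver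

c≡!*compositionSum : ∀ p ℓ → ℓ < p → c p ℓ ≡ ℕ→ℚ (p !) *ℚ a p (p ∸ ℓ)
c≡!*compositionSum p ℓ ℓ<p = subst (λ q → c q ℓ ≡ ℕ→ℚ (q !) *ℚ a q (q ∸ ℓ)) (ℕ.m+[n∸m]≡n ℓ<p) (begin
  c q ℓ
    ≡⟨ Σℚ-map-filter (concatMap (λ m → tuples m ℓ) (range 0 (q + ℓ))) (admissible q ℓ) (term q) ⟩
  sumWhere (concatMap (λ m → tuples m ℓ) (range 0 (q + ℓ))) (admissible q ℓ) (term q)
    ≡⟨ sumWhere-concatMap (λ m → tuples m ℓ) (range 0 (q + ℓ)) (admissible q ℓ) (term q) ⟩
  Σℚ (map (λ m → sumWhere (tuples m ℓ) (admissible q ℓ) (term q)) (range 0 (q + ℓ)))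
    ≡⟨ Σℚ-map-range 0 (suc (q + ℓ)) (λ m → sumWhere (tuples m ℓ) (admissible q ℓ) (term q)) ⟩
  tupleSum ℓ (q + ℓ) (admissible q ℓ) (λ ks → ℕ→ℚ (q !) *ℚ weight ks)
    ≡⟨ *-distribˡ-tupleSum ℓ (q + ℓ) (admissible q ℓ) (ℕ→ℚ (q !)) weight ⟩
  ℕ→ℚ (q !) *ℚ tupleSum ℓ (q + ℓ) (admissible q ℓ) weight
    ≡⟨ cong (ℕ→ℚ (q !) *ℚ_) (tupleSum-cong ℓ (q + ℓ) weight (admissible≡hasShape ℓ z)) ⟩
  ℕ→ℚ (q !) *ℚ tupleSum ℓ (q + ℓ) (hasShape ℓ z false) weight
    ≡⟨ cong (ℕ→ℚ (q !) *ℚ_) (shapeSum-free ℓ (q + ℓ) ℓ z ℕ.≤-refl (ℕ.≤-trans (ℕ.n≤1+n (ℓ + z)) (ℕ.m≤m+n q ℓ))) ⟩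
  ℕ→ℚ (q !) *ℚ a q (suc z)
    ≡⟨ cong (λ j → ℕ→ℚ (q !) *ℚ a q j) (trans (ℕ.+-∸-assoc 1 (ℕ.m≤m+n ℓ z)) (cong suc (ℕ.m+n∸m≡n ℓ z))) ⟨
  ℕ→ℚ (q !) *ℚ a q (q ∸ ℓ) ∎)
  where
  open ≡-Reasoning
  z = p ∸ suc ℓ
  q = suc (ℓ + z)

-- (p ∸ ℓ)! S(p, p ∸ ℓ), the number of surjections from a p-set onto a (p ∸ ℓ)-set.
surj : ℕ → ℕ → ℚ
surj p ℓ = ℕ→ℚ (p !) *ℚ a p (p ∸ ℓ)

surjPrev : ℕ → ℕ → ℚ
surjPrev p zero    = 0ℚ
surjPrev p (suc ℓ) = surj p ℓ

surjPrev≡ : ∀ p ℓ → ℓ ≤ p → surjPrev p ℓ ≡ ℕ→ℚ (p !) *ℚ a p (suc (p ∸ ℓ))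
surjPrev≡ p zero    _   = sym (trans (cong (ℕ→ℚ (p !) *ℚ_) (compositionSum-< (ℕ.n<1+n p))) (ℚ.*-zeroʳ (ℕ→ℚ (p !))))
surjPrev≡ p (suc ℓ) ℓ<p = cong (λ j → ℕ→ℚ (p !) *ℚ a p j) (ℕ.+-∸-assoc 1 ℓ<p)

surj-suc : ∀ p ℓ → ℓ ≤ suc p → surj (suc p) ℓ ≡ ℕ→ℚ (suc p ∸ ℓ) *ℚ (surjPrev p ℓ +ℚ surj p ℓ)
surj-suc p ℓ ℓ≤1+p with ℕ.m≤n⇒m<n∨m≡n ℓ≤1+p
... | inj₂ refl = begin
  ℕ→ℚ (suc p !) *ℚ a (suc p) (p ∸ p)            ≡⟨ cong (λ j → ℕ→ℚ (suc p !) *ℚ a (suc p) j) (ℕ.n∸n≡0 p) ⟩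
  ℕ→ℚ (suc p !) *ℚ 0ℚ                           ≡⟨ ℚ.*-zeroʳ (ℕ→ℚ (suc p !)) ⟩
  0ℚ                                            ≡⟨ ℚ.*-zeroˡ (surjPrev p (suc p) +ℚ surj p (suc p)) ⟨
  ℕ→ℚ 0 *ℚ (surjPrev p (suc p) +ℚ surj p (suc p)) ≡⟨ cong (λ n → ℕ→ℚ n *ℚ (surjPrev p (suc p) +ℚ surj p (suc p))) (ℕ.n∸n≡0 p) ⟨
  ℕ→ℚ (p ∸ p) *ℚ (surjPrev p (suc p) +ℚ surj p (suc p)) ∎
  where open ≡-Reasoning
... | inj₁ (s≤s ℓ≤p) = begin
  ℕ→ℚ (suc p !) *ℚ a (suc p) (suc p ∸ ℓ)
    ≡⟨ cong (λ n → ℕ→ℚ (suc p !) *ℚ a (suc p) n) 1+p∸ℓ ⟩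
  ℕ→ℚ (suc p !) *ℚ a (suc p) (suc j)
    ≡⟨ cong (_*ℚ a (suc p) (suc j)) (ℕ→ℚ-* (suc p) (p !)) ⟩
  ℕ→ℚ (suc p) *ℚ ℕ→ℚ (p !) *ℚ a (suc p) (suc j)
    ≡⟨ solve 3 (λ x y s → x :* y :* s := y :* (x :* s)) refl (ℕ→ℚ (suc p)) (ℕ→ℚ (p !)) (a (suc p) (suc j)) ⟩
  ℕ→ℚ (p !) *ℚ (ℕ→ℚ (suc p) *ℚ a (suc p) (suc j))
    ≡⟨ cong (ℕ→ℚ (p !) *ℚ_) (compositionSum-suc-suc j p) ⟩
  ℕ→ℚ (p !) *ℚ (ℕ→ℚ (suc j) *ℚ (a p (suc j) +ℚ a p j))
    ≡⟨ solve 4 (λ y k s t → y :* (k :* (s :+ t)) := k :* (y :* s :+ y :* t)) refl (ℕ→ℚ (p !)) (ℕ→ℚ (suc j)) (a p (suc j)) (a p j) ⟩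
  ℕ→ℚ (suc j) *ℚ (ℕ→ℚ (p !) *ℚ a p (suc j) +ℚ surj p ℓ)
    ≡⟨ cong₂ (λ n x → ℕ→ℚ n *ℚ (x +ℚ surj p ℓ)) 1+p∸ℓ (surjPrev≡ p ℓ ℓ≤p) ⟨
  ℕ→ℚ (suc p ∸ ℓ) *ℚ (surjPrev p ℓ +ℚ surj p ℓ) ∎
  where
  open ≡-Reasoning
  open +-*-Solver
  j = p ∸ ℓ
  1+p∸ℓ : suc p ∸ ℓ ≡ suc j
  1+p∸ℓ = ℕ.+-∸-assoc 1 ℓ≤p

[k+1]*[m+1]C[k+1]≡[m+1]*mCk : ∀ m k → suc k * (suc m C suc k) ≡ suc m * (m C k)
[k+1]*[m+1]C[k+1]≡[m+1]*mCk zero    zero    = refl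
[k+1]*[m+1]C[k+1]≡[m+1]*mCk zero    (suc k) = ℕ.*-zeroʳ (suc (suc k))
[k+1]*[m+1]C[k+1]≡[m+1]*mCk (suc m) zero    =
  trans (ℕ.+-identityʳ _) (trans (nC1≡n (suc (suc m))) (sym (ℕ.*-identityʳ (suc (suc m)))))
[k+1]*[m+1]C[k+1]≡[m+1]*mCk (suc m) (suc k) = begin
  suc (suc k) * (suc (suc m) C suc (suc k))
    ≡⟨ cong (suc (suc k) *_) (nCk+nC[k+1]≡[n+1]C[k+1] (suc m) (suc k)) ⟨
  suc (suc k) * (x + y)
    ≡⟨ solve 3 (λ k x y → (con 2 :+ k) :* (x :+ y) := x :+ (con 1 :+ k) :* x :+ (con 2 :+ k) :* y) refl k x y ⟩
  x + suc k * x + suc (suc k) * y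
    ≡⟨ cong₂ (λ s t → x + s + t) ([k+1]*[m+1]C[k+1]≡[m+1]*mCk m k) ([k+1]*[m+1]C[k+1]≡[m+1]*mCk m (suc k)) ⟩
  x + suc m * (m C k) + suc m * (m C suc k)
    ≡⟨ solve 4 (λ x m s t → x :+ (con 1 :+ m) :* s :+ (con 1 :+ m) :* t := x :+ (con 1 :+ m) :* (s :+ t))
               refl x m (m C k) (m C suc k) ⟩
  x + suc m * (m C k + m C suc k)
    ≡⟨ cong (λ t → x + suc m * t) (nCk+nC[k+1]≡[n+1]C[k+1] m k) ⟩
  suc (suc m) * x ∎
  where
  open ≡-Reasoning
  open ℕ-Solver.+-*-Solver
  x = suc m C suc k
  y = suc m C suc (suc k)

F-absorb : ∀ n k → suc n * F (suc n) k + k * F (suc n) k ≡ suc k * F (suc n) (suc k)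
F-absorb n k = begin
  suc n * ((n + k) C k) + k * ((n + k) C k) ≡⟨ ℕ.*-distribʳ-+ ((n + k) C k) (suc n) k ⟨
  suc (n + k) * ((n + k) C k)               ≡⟨ [k+1]*[m+1]C[k+1]≡[m+1]*mCk (n + k) k ⟨
  suc k * (suc (n + k) C suc k)             ≡⟨ cong (λ m → suc k * (m C suc k)) (ℕ.+-suc n k) ⟨
  suc k * ((n + suc k) C suc k)             ∎
  where open ≡-Reasoning

F-absorbℚ : ∀ n k → ℕ→ℚ (suc n) *ℚ ℕ→ℚ (F (suc n) k) +ℚ ℕ→ℚ k *ℚ ℕ→ℚ (F (suc n) k)
                    ≡ ℕ→ℚ (suc k) *ℚ ℕ→ℚ (F (suc n) (suc k))
F-absorbℚ n k = begin
  ℕ→ℚ (suc n) *ℚ ℕ→ℚ (F (suc n) k) +ℚ ℕ→ℚ k *ℚ ℕ→ℚ (F (suc n) k)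
    ≡⟨ cong₂ _+ℚ_ (ℕ→ℚ-* (suc n) (F (suc n) k)) (ℕ→ℚ-* k (F (suc n) k)) ⟨
  ℕ→ℚ (suc n * F (suc n) k) +ℚ ℕ→ℚ (k * F (suc n) k)
    ≡⟨ ℕ→ℚ-+ (suc n * F (suc n) k) (k * F (suc n) k) ⟨
  ℕ→ℚ (suc n * F (suc n) k + k * F (suc n) k)
    ≡⟨ cong ℕ→ℚ (F-absorb n k) ⟩
  ℕ→ℚ (suc k * F (suc n) (suc k))
    ≡⟨ ℕ→ℚ-* (suc k) (F (suc n) (suc k)) ⟩
  ℕ→ℚ (suc k) *ℚ ℕ→ℚ (F (suc n) (suc k)) ∎
  where open ≡-Reasoning

F-pascal : ∀ n k → F n (suc k) + F (suc n) k ≡ F (suc n) (suc k)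
F-pascal n k = begin
  F n (suc k) + F (suc n) k     ≡⟨ cong (λ m → (m ∸ 1) C suc k + (n + k) C k) (ℕ.+-suc n k) ⟩
  (n + k) C suc k + (n + k) C k ≡⟨ ℕ.+-comm ((n + k) C suc k) ((n + k) C k) ⟩
  (n + k) C k + (n + k) C suc k ≡⟨ nCk+nC[k+1]≡[n+1]C[k+1] (n + k) k ⟩
  suc (n + k) C suc k           ≡⟨ cong (λ m → m C suc k) (ℕ.+-suc n k) ⟨
  F (suc n) (suc k)             ∎
  where open ≡-Reasoning

∑-F≡F-suc : ∀ n k → ∑[ r < n ] ℕ→ℚ (F (suc r) k) ≡ ℕ→ℚ (F n (suc k))
∑-F≡F-suc zero    k = cong ℕ→ℚ (sym (k>n⇒nCk≡0 (ℕ.n<1+n k)))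
∑-F≡F-suc (suc n) k = begin
  ∑[ r < suc n ] ℕ→ℚ (F (suc r) k)            ≡⟨ ∑-init-last n (λ r → ℕ→ℚ (F (suc r) k)) ⟩
  ∑[ r < n ] ℕ→ℚ (F (suc r) k) +ℚ ℕ→ℚ (F (suc n) k) ≡⟨ cong (_+ℚ ℕ→ℚ (F (suc n) k)) (∑-F≡F-suc n k) ⟩
  ℕ→ℚ (F n (suc k)) +ℚ ℕ→ℚ (F (suc n) k)       ≡⟨ ℕ→ℚ-+ (F n (suc k)) (F (suc n) k) ⟨
  ℕ→ℚ (F n (suc k) + F (suc n) k)             ≡⟨ cong ℕ→ℚ (F-pascal n k) ⟩
  ℕ→ℚ (F (suc n) (suc k))                     ∎
  where open ≡-Reasoning

∑-shift-second : ∀ p (f g : ℕ → ℚ) → f (suc p) ≡ 0ℚ → g 0 ≡ 0ℚ →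
                 ∑[ ℓ < suc (suc p) ] (f ℓ +ℚ g ℓ) ≡ ∑[ ℓ < suc p ] (f ℓ +ℚ g (suc ℓ))
∑-shift-second p f g f[1+p]≡0 g0≡0 = begin
  ∑[ ℓ < suc (suc p) ] (f ℓ +ℚ g ℓ)                 ≡⟨ ∑-+ (suc (suc p)) f g ⟩
  ∑ (suc (suc p)) f +ℚ (g 0 +ℚ ∑ (suc p) (g ∘ suc)) ≡⟨ cong₂ (λ x y → x +ℚ (y +ℚ ∑ (suc p) (g ∘ suc))) (∑-init-last (suc p) f) g0≡0 ⟩
  (∑ (suc p) f +ℚ f (suc p)) +ℚ (0ℚ +ℚ ∑ (suc p) (g ∘ suc))
    ≡⟨ cong₂ (λ x y → (∑ (suc p) f +ℚ x) +ℚ y) f[1+p]≡0 (ℚ.+-identityˡ (∑ (suc p) (g ∘ suc))) ⟩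
  (∑ (suc p) f +ℚ 0ℚ) +ℚ ∑ (suc p) (g ∘ suc)        ≡⟨ cong (_+ℚ ∑ (suc p) (g ∘ suc)) (ℚ.+-identityʳ (∑ (suc p) f)) ⟩
  ∑ (suc p) f +ℚ ∑ (suc p) (g ∘ suc)                ≡⟨ ∑-+ (suc p) f (g ∘ suc) ⟨
  ∑[ ℓ < suc p ] (f ℓ +ℚ g (suc ℓ))                 ∎
  where open ≡-Reasoning

module _ (n : ℕ) where

  Fℚ : ℕ → ℚ
  Fℚ k = ℕ→ℚ (F (suc n) k)

  alternatingSum : ℕ → ℚ
  alternatingSum p = ∑[ ℓ < suc p ] sgn ℓ *ℚ surj p ℓ *ℚ Fℚ (p ∸ ℓ)

  -- (k + 1) Fₙᵏ⁺¹ = n Fₙᵏ + k Fₙᵏ makes consecutive terms telescope after surj-suc.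
  alternatingSum-suc : ∀ p → alternatingSum (suc p) ≡ ℕ→ℚ (suc n) *ℚ alternatingSum p
  alternatingSum-suc p = begin
    alternatingSum (suc p)                                 ≡⟨ ∑-cong (suc (suc p)) (λ ℓ ℓ<2+p → split ℓ (ℕ.≤-pred ℓ<2+p)) ⟩
    ∑[ ℓ < suc (suc p) ] (f ℓ +ℚ g ℓ)                      ≡⟨ ∑-shift-second p f g f[1+p]≡0 (ℚ.*-zeroˡ (kF (suc p))) ⟩
    ∑[ ℓ < suc p ] (f ℓ +ℚ g (suc ℓ))                      ≡⟨ ∑-cong (suc p) (λ ℓ ℓ<1+p → merge ℓ (ℕ.≤-pred ℓ<1+p)) ⟩
    ∑[ ℓ < suc p ] ℕ→ℚ (suc n) *ℚ (sgn ℓ *ℚ surj p ℓ *ℚ Fℚ (p ∸ ℓ))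
      ≡⟨ *-distribˡ-∑ (suc p) (ℕ→ℚ (suc n)) (λ ℓ → sgn ℓ *ℚ surj p ℓ *ℚ Fℚ (p ∸ ℓ)) ⟩
    ℕ→ℚ (suc n) *ℚ alternatingSum p                        ∎
    where
    open ≡-Reasoning
    open +-*-Solver
    kF : ℕ → ℚ
    kF k = ℕ→ℚ k *ℚ Fℚ k
    f g : ℕ → ℚ
    f ℓ = sgn ℓ *ℚ surj p ℓ *ℚ kF (suc p ∸ ℓ)
    g ℓ = sgn ℓ *ℚ surjPrev p ℓ *ℚ kF (suc p ∸ ℓ)
    split : ∀ ℓ → ℓ ≤ suc p → sgn ℓ *ℚ surj (suc p) ℓ *ℚ Fℚ (suc p ∸ ℓ) ≡ f ℓ +ℚ g ℓ
    split ℓ ℓ≤1+p = trans (cong (λ x → sgn ℓ *ℚ x *ℚ Fℚ (suc p ∸ ℓ)) (surj-suc p ℓ ℓ≤1+p))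
      (solve 5 (λ s k u t x → s :* (k :* (u :+ t)) :* x := s :* t :* (k :* x) :+ s :* u :* (k :* x)) refl
         (sgn ℓ) (ℕ→ℚ (suc p ∸ ℓ)) (surjPrev p ℓ) (surj p ℓ) (Fℚ (suc p ∸ ℓ)))
    f[1+p]≡0 : f (suc p) ≡ 0ℚ
    f[1+p]≡0 = begin
      sgn (suc p) *ℚ surj p (suc p) *ℚ kF (p ∸ p) ≡⟨ cong (λ k → sgn (suc p) *ℚ surj p (suc p) *ℚ kF k) (ℕ.n∸n≡0 p) ⟩
      sgn (suc p) *ℚ surj p (suc p) *ℚ kF 0       ≡⟨ cong (sgn (suc p) *ℚ surj p (suc p) *ℚ_) (ℚ.*-zeroˡ (Fℚ 0)) ⟩
      sgn (suc p) *ℚ surj p (suc p) *ℚ 0ℚ         ≡⟨ ℚ.*-zeroʳ (sgn (suc p) *ℚ surj p (suc p)) ⟩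
      0ℚ                                          ∎
    merge : ∀ ℓ → ℓ ≤ p → f ℓ +ℚ g (suc ℓ) ≡ ℕ→ℚ (suc n) *ℚ (sgn ℓ *ℚ surj p ℓ *ℚ Fℚ (p ∸ ℓ))
    merge ℓ ℓ≤p = begin
      sgn ℓ *ℚ surj p ℓ *ℚ kF (suc p ∸ ℓ) +ℚ (- sgn ℓ) *ℚ surj p ℓ *ℚ kF k
        ≡⟨ cong (λ m → sgn ℓ *ℚ surj p ℓ *ℚ kF m +ℚ (- sgn ℓ) *ℚ surj p ℓ *ℚ kF k) (ℕ.+-∸-assoc 1 ℓ≤p) ⟩
      sgn ℓ *ℚ surj p ℓ *ℚ kF (suc k) +ℚ (- sgn ℓ) *ℚ surj p ℓ *ℚ kF k
        ≡⟨ cong (λ x → sgn ℓ *ℚ surj p ℓ *ℚ x +ℚ (- sgn ℓ) *ℚ surj p ℓ *ℚ kF k) (F-absorbℚ n k) ⟨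
      sgn ℓ *ℚ surj p ℓ *ℚ (ℕ→ℚ (suc n) *ℚ Fℚ k +ℚ kF k) +ℚ (- sgn ℓ) *ℚ surj p ℓ *ℚ kF k
        ≡⟨ solve 5 (λ s t m x y → s :* t :* (m :* x :+ y) :+ (:- s) :* t :* y := m :* (s :* t :* x)) refl
             (sgn ℓ) (surj p ℓ) (ℕ→ℚ (suc n)) (Fℚ k) (kF k) ⟩
      ℕ→ℚ (suc n) *ℚ (sgn ℓ *ℚ surj p ℓ *ℚ Fℚ k) ∎
      where k = p ∸ ℓ

  alternatingSum≡^ : ∀ p → alternatingSum p ≡ ℕ→ℚ (suc n ^ p)
  alternatingSum≡^ zero    = refl
  alternatingSum≡^ (suc p) = begin
    alternatingSum (suc p)                 ≡⟨ alternatingSum-suc p ⟩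
    ℕ→ℚ (suc n) *ℚ alternatingSum p        ≡⟨ cong (ℕ→ℚ (suc n) *ℚ_) (alternatingSum≡^ p) ⟩
    ℕ→ℚ (suc n) *ℚ ℕ→ℚ (suc n ^ p)         ≡⟨ ℕ→ℚ-* (suc n) (suc n ^ p) ⟨
    ℕ→ℚ (suc n ^ suc p)                    ∎
    where open ≡-Reasoning

power≡∑c : ∀ n p → ℕ→ℚ (suc n ^ suc p) ≡ ∑[ ℓ < suc p ] sgn ℓ *ℚ c (suc p) ℓ *ℚ ℕ→ℚ (F (suc n) (suc p ∸ ℓ))
power≡∑c n p = begin
  ℕ→ℚ (suc n ^ suc p)                       ≡⟨ alternatingSum≡^ n (suc p) ⟨
  ∑[ ℓ < suc (suc p) ] g ℓ                  ≡⟨ ∑-init-last (suc p) g ⟩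
  ∑[ ℓ < suc p ] g ℓ +ℚ g (suc p)           ≡⟨ cong (∑[ ℓ < suc p ] g ℓ +ℚ_) last≡0 ⟩
  ∑[ ℓ < suc p ] g ℓ +ℚ 0ℚ                  ≡⟨ ℚ.+-identityʳ _ ⟩
  ∑[ ℓ < suc p ] g ℓ                        ≡⟨ ∑-cong (suc p) (λ ℓ ℓ<1+p → cong (λ x → sgn ℓ *ℚ x *ℚ Fℚ n (suc p ∸ ℓ))
                                                                    (sym (c≡!*compositionSum (suc p) ℓ ℓ<1+p))) ⟩
  ∑[ ℓ < suc p ] sgn ℓ *ℚ c (suc p) ℓ *ℚ ℕ→ℚ (F (suc n) (suc p ∸ ℓ)) ∎
  where
  open ≡-Reasoning
  g : ℕ → ℚ
  g ℓ = sgn ℓ *ℚ surj (suc p) ℓ *ℚ Fℚ n (suc p ∸ ℓ)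
  last≡0 : g (suc p) ≡ 0ℚ
  last≡0 = begin
    sgn (suc p) *ℚ (ℕ→ℚ (suc p !) *ℚ a (suc p) (p ∸ p)) *ℚ Fℚ n (p ∸ p)
      ≡⟨ cong (λ j → sgn (suc p) *ℚ (ℕ→ℚ (suc p !) *ℚ a (suc p) j) *ℚ Fℚ n j) (ℕ.n∸n≡0 p) ⟩
    sgn (suc p) *ℚ (ℕ→ℚ (suc p !) *ℚ 0ℚ) *ℚ 1ℚ
      ≡⟨ cong (λ x → sgn (suc p) *ℚ x *ℚ 1ℚ) (ℚ.*-zeroʳ (ℕ→ℚ (suc p !))) ⟩
    sgn (suc p) *ℚ 0ℚ *ℚ 1ℚ
      ≡⟨ cong (_*ℚ 1ℚ) (ℚ.*-zeroʳ (sgn (suc p))) ⟩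
    0ℚ *ℚ 1ℚ
      ≡⟨ ℚ.*-zeroˡ 1ℚ ⟩
    0ℚ ∎

∑power≡∑c : ∀ n p → ∑[ r < n ] ℕ→ℚ (suc r ^ suc p) ≡ ∑[ ℓ < suc p ] sgn ℓ *ℚ c (suc p) ℓ *ℚ ℕ→ℚ (F n (suc (suc p ∸ ℓ)))
∑power≡∑c n p = begin
  ∑[ r < n ] ℕ→ℚ (suc r ^ suc p)                        ≡⟨ ∑-cong n (λ r _ → power≡∑c r p) ⟩
  ∑[ r < n ] ∑[ ℓ < suc p ] cF ℓ *ℚ ℕ→ℚ (F (suc r) (suc p ∸ ℓ)) ≡⟨ ∑-comm n (suc p) (λ r ℓ → cF ℓ *ℚ ℕ→ℚ (F (suc r) (suc p ∸ ℓ))) ⟩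
  ∑[ ℓ < suc p ] ∑[ r < n ] cF ℓ *ℚ ℕ→ℚ (F (suc r) (suc p ∸ ℓ))
    ≡⟨ ∑-cong (suc p) (λ ℓ _ → *-distribˡ-∑ n (cF ℓ) (λ r → ℕ→ℚ (F (suc r) (suc p ∸ ℓ)))) ⟩
  ∑[ ℓ < suc p ] cF ℓ *ℚ (∑[ r < n ] ℕ→ℚ (F (suc r) (suc p ∸ ℓ)))
    ≡⟨ ∑-cong (suc p) (λ ℓ _ → cong (cF ℓ *ℚ_) (∑-F≡F-suc n (suc p ∸ ℓ))) ⟩
  ∑[ ℓ < suc p ] cF ℓ *ℚ ℕ→ℚ (F n (suc (suc p ∸ ℓ)))   ∎
  where
  open ≡-Reasoning
  cF : ℕ → ℚ
  cF ℓ = sgn ℓ *ℚ c (suc p) ℓ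

mainTheorem1 : (n p : ℕ) → 1 ≤ n → 1 ≤ p →
    (ℕ→ℚ (n ^ p) ≡ Σℚ (map (λ ℓ → sgn ℓ *ℚ c p ℓ *ℚ ℕ→ℚ (F n (p ∸ ℓ))) (range 0 (p ∸ 1))))
    × (Σℚ (map (λ r → ℕ→ℚ (r ^ p)) (range 1 n))
        ≡ Σℚ (map (λ i → sgn (i ∸ 1) *ℚ c p (i ∸ 1) *ℚ ℕ→ℚ (F n (p ∸ i + 2))) (range 1 p)))
mainTheorem1 (suc n) (suc p) _ _ =
  trans (power≡∑c n p) (sym (Σℚ-map-range 0 (suc p) (λ ℓ → sgn ℓ *ℚ c (suc p) ℓ *ℚ ℕ→ℚ (F (suc n) (suc p ∸ ℓ))))) ,
  (begin
    Σℚ (map (λ r → ℕ→ℚ (r ^ suc p)) (range 1 (suc n)))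
      ≡⟨ Σℚ-map-range 1 (suc n) (λ r → ℕ→ℚ (r ^ suc p)) ⟩
    ∑[ r < suc n ] ℕ→ℚ (suc r ^ suc p)
      ≡⟨ ∑power≡∑c (suc n) p ⟩
    ∑[ ℓ < suc p ] sgn ℓ *ℚ c (suc p) ℓ *ℚ ℕ→ℚ (F (suc n) (suc (suc p ∸ ℓ)))
      ≡⟨ ∑-cong (suc p) (λ ℓ ℓ<1+p → cong (λ k → sgn ℓ *ℚ c (suc p) ℓ *ℚ ℕ→ℚ (F (suc n) k)) (1+[1+p∸ℓ] ℓ ℓ<1+p)) ⟩
    ∑[ ℓ < suc p ] sgn ℓ *ℚ c (suc p) ℓ *ℚ ℕ→ℚ (F (suc n) (p ∸ ℓ + 2))
      ≡⟨ Σℚ-map-range 1 (suc p) (λ i → sgn (i ∸ 1) *ℚ c (suc p) (i ∸ 1) *ℚ ℕ→ℚ (F (suc n) (suc p ∸ i + 2))) ⟨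
    Σℚ (map (λ i → sgn (i ∸ 1) *ℚ c (suc p) (i ∸ 1) *ℚ ℕ→ℚ (F (suc n) (suc p ∸ i + 2))) (range 1 (suc p))) ∎)
  where
  open ≡-Reasoning
  1+[1+p∸ℓ] : ∀ ℓ → ℓ < suc p → suc (suc p ∸ ℓ) ≡ p ∸ ℓ + 2
  1+[1+p∸ℓ] ℓ (s≤s ℓ≤p) = trans (cong suc (ℕ.+-∸-assoc 1 ℓ≤p)) (ℕ.+-comm 2 (p ∸ ℓ))
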